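{- Let $m\ge0$ be an integer and let $s_n$ be defined by $s_n=\delta_{n,0}+s_{n-1}+s_{n-m-2}$ for $n\ge0$ and $s_n=0$ for $n<0$. Then for all $n\ge0$ and $j=0,\ldots,m+1$, \[ s_{n(m+2)+j}^2=\delta_{j,0}+(1-\delta_{j,0})s_{j-1}^2+\sum_{k=1}^n\left\{s_{k(m+2)+j-1}^2+2\sum_{i=0}^{(k-1)(m+2)+j}P_{k(m+2)+j-1-i}^{\{ -2,-1,m\}}s_i^2\right\}. \]
   Context: $\delta_{i,j}$ is $1$ if $i=j$ and $0$ otherwise. For a finite set $W$ of integers, $P_n^W$ is the number of permutations $\pi$ of $\{1,\ldots,n\}$ with $\pi(i)-i\in W$ for all $i$ (equivalently, the permanent of the $n\times n$ $(0,1)$ matrix whose $(i,j)$ entry is $1$ iff $j-i\in W$), with $P_0^W=1$. -}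

module Defs where

open import Data.Nat using (ℕ; zero; suc; _+_; _∸_)
open import Data.Bool using (Bool; true; false; _∧_; _∨_; if_then_else_)
open import Data.List using (List; []; _∷_; map; concatMap; length; filterᵇ; upTo; applyUpTo)
open import Data.Bool.ListAction using (any)
open import Data.Nat.ListAction using (sum)
open import Data.Integer using (ℤ; +_; _-_)
import Data.Integer as ℤ
import Data.Nat as ℕ
open import Relation.Nullary.Decidable using (does)

δ : ℕ → ℕ → ℕ
δ i j = if does (i ℕ.≟ j) then 1 else 0

insertions : {A : Set} → A → List A → List (List A)
insertions x []       = (x ∷ []) ∷ []
insertions x (y ∷ ys) = (x ∷ y ∷ ys) ∷ map (y ∷_) (insertions x ys)

perms : {A : Set} → List A → List (List A)
perms []       = [] ∷ []
perms (x ∷ xs) = concatMap (insertions x) (perms xs)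

_∈ᵇ_ : ℤ → List ℤ → Bool
z ∈ᵇ W = any (λ w → does (z ℤ.≟ w)) W

-- a permutation π of {0,…,n-1}, given as the list [π(0), …, π(n-1)],
-- starting at position i: check π(i) - i ∈ W for every position
respects : List ℤ → ℕ → List ℕ → Bool
respects W i []       = true
respects W i (v ∷ vs) = ((+ v) - (+ i)) ∈ᵇ W ∧ respects W (suc i) vs

-- P n W : number of permutations π of {1,…,n} with π(i) - i ∈ W for all i
-- (positions/values shifted to {0,…,n-1}, which does not change differences).
-- P 0 W = 1 (the empty permutation).
P : ℕ → List ℤ → ℕ
P n W = length (filterᵇ (λ π → respects W 0 π) (perms (upTo n)))

-- ∑ a b f = f a + f (a+1) + … + f b  (empty, i.e. 0, if b < a)
∑ : ℕ → ℕ → (ℕ → ℕ) → ℕ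
∑ a b f = sum (map f (applyUpTo (λ t → a + t) (suc b ∸ a)))

-- A permutation π with π(i) − i ∈ {−2, −1, m} is read position by position. At any moment at
-- most two values above the current position are already used (by steps m), so the number of
-- ways to finish depends only on their distances u > v from the largest value: call it E(u, v),
-- so that P_n = E(n + 1, n). The first move of the permutation gives a recursion for E that
-- mirrors the recurrence of s, and a joint strong induction on u proves
--   s_u s_{v−1} + s_{u−1} s_v = E(u, v) + 2 Σ_j s_{u−1−j} s_{v−1−j} P_j   (v < u),
--   s_w s_{w−1} = Σ_j s_{w−1−j}² P_j.
-- For w = N + m + 2 we have s_w = s_{w−1} + s_N, P_0 = 1 and P_1 = … = P_m = 0, so the second
-- identity yields s_{N+m+1} s_N = Σ_{i ≤ N} P_{N+m+1−i} s_i². Squaring s_w = s_{w−1} + s_N then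
-- telescopes to the theorem.

module Submission where

open import Defs
open import Algebra.Properties.CommutativeSemigroup using (interchange)
open import Data.Bool using (Bool; true; false; _∧_; if_then_else_)
open import Data.Integer using (ℤ; +_; -[1+_]; _-_; _⊖_)
import Data.Integer as ℤ
open import Data.Integer.Properties using ([+m]-[+n]≡m⊖n; +-cancelˡ-⊖; [1+m]⊖[1+n]≡m⊖n)
open import Data.List using (List; []; _∷_; _++_; map; concatMap; length; filterᵇ; upTo; applyUpTo)
open import Data.List.Properties using (map-++; map-∘; map-cong; concatMap-map; map-concatMap; concatMap-cong)
open import Data.List.Membership.Propositional using (_∈_; _∉_)
open import Data.List.Membership.Propositional.Properties using (∈-map⁺; ∈-map⁻; ∈-upTo⁺; ∈-upTo⁻)
open import Data.List.Relation.Unary.All using (tabulate; lookup)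
open import Data.List.Relation.Unary.AllPairs using (_∷_)
open import Data.List.Relation.Unary.Any using (here; there)
open import Data.List.Relation.Unary.Any.Properties using (¬Any[])
open import Data.List.Relation.Unary.Unique.Propositional using (Unique)
import Data.List.Relation.Unary.Unique.Propositional.Properties as Unique
open import Data.Nat using (ℕ; zero; suc; _+_; _*_; _∸_; _^_; _≤_; _<_; _≟_; _≤?_; _⊔_; _⊓_; z≤n; s≤s)
open import Data.Nat.Induction using (<-rec)
open import Data.Nat.ListAction using (sum)
open import Data.Nat.ListAction.Properties using (sum-++)
open import Data.Nat.Properties
open import Data.Nat.Tactic.RingSolver using (solve-∀)
open import Data.Product using (_×_; _,_; proj₁; proj₂)
open import Data.Sum using (inj₁; inj₂)
open import Function using (_∘_)
open import Relation.Nullary using (¬_; Dec; yes; no; contradiction)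
open import Relation.Nullary.Decidable using (¬?; dec-true)
open import Relation.Binary.PropositionalEquality

open ≡-Reasoning

+-interchange : ∀ a b c d → (a + b) + (c + d) ≡ (a + c) + (b + d)
+-interchange = interchange +-commutativeSemigroup

when : {Q : Set} → Dec Q → ℕ → ℕ
when (yes _) x = x
when (no _)  _ = 0

unless : {Q : Set} → Dec Q → ℕ → ℕ
unless d = when (¬? d)

when-cong : {Q : Set} (d : Dec Q) {x y : ℕ} → (Q → x ≡ y) → when d x ≡ when d y
when-cong (yes q) e = e q
when-cong (no _)  e = refl

when-+ : {Q : Set} (d : Dec Q) → ∀ x y → when d x + when d y ≡ when d (x + y)
when-+ (yes _) x y = refl
when-+ (no _)  x y = refl

when-iff : {Q Q′ : Set} (d : Dec Q) (d′ : Dec Q′) {x : ℕ} → (Q → Q′) → (Q′ → Q) → when d x ≡ when d′ x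
when-iff (yes _) (yes _)  _ _ = refl
when-iff (no _)  (no _)   _ _ = refl
when-iff (yes q) (no ¬q′) f _ = contradiction (f q) ¬q′
when-iff (no ¬q) (yes q′) _ g = contradiction (g q′) ¬q

unless-cong : {Q : Set} (d : Dec Q) {x y : ℕ} → (¬ Q → x ≡ y) → unless d x ≡ unless d y
unless-cong d = when-cong (¬? d)

unless-iff : {Q Q′ : Set} (d : Dec Q) (d′ : Dec Q′) {x : ℕ} → (Q → Q′) → (Q′ → Q) → unless d x ≡ unless d′ x
unless-iff d d′ f g = when-iff (¬? d) (¬? d′) (λ ¬q q′ → ¬q (g q′)) (λ ¬q′ q → ¬q′ (f q))

when-scale : {Q : Set} (d : Dec Q) → ∀ x y z p → (x + when d y) * z * p ≡ x * z * p + when d (y * z * p)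
when-scale (yes _) x y z p = trans (cong (_* p) (*-distribʳ-+ z x y)) (*-distribʳ-+ p (x * z) (y * z))
when-scale (no _)  x y z p = trans (cong (λ t → t * z * p) (+-identityʳ x)) (sym (+-identityʳ _))

when-bilinear : {Q : Set} (d : Dec Q) → ∀ p b q c x y →
  (p + when d b) * x + (q + when d c) * y ≡ (p * x + q * y) + when d (b * x + c * y)
when-bilinear (yes _) p b q c x y =
  trans (cong₂ _+_ (*-distribʳ-+ x p b) (*-distribʳ-+ y q c)) (+-interchange (p * x) (b * x) (q * y) (c * y))
when-bilinear (no _)  p b q c x y = trans (cong₂ (λ s t → s * x + t * y) (+-identityʳ p) (+-identityʳ q)) (sym (+-identityʳ _))

when-square : {Q : Set} (d : Dec Q) → ∀ x y p → (x + when d y) * (x + when d y) * p ≡ x * x * p + when d (2 * (x * y * p) + y * y * p)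
when-square (yes _) x y p = square x y p
  where
  square : ∀ x y p → (x + y) * (x + y) * p ≡ x * x * p + (2 * (x * y * p) + y * y * p)
  square = solve-∀
when-square (no _)  x y p = trans (cong (λ t → t * t * p) (+-identityʳ x)) (sym (+-identityʳ _))

when-product : {Q : Set} (d : Dec Q) → ∀ x b x′ c → (x + when d b) * (x′ + when d c) ≡ x * x′ + when d (x * c + x′ * b + b * c)
when-product (yes _) x b x′ c = product x b x′ c
  where
  product : ∀ x b x′ c → (x + b) * (x′ + c) ≡ x * x′ + (x * c + x′ * b + b * c)
  product = solve-∀
when-product (no _)  x b x′ c = trans (cong₂ _*_ (+-identityʳ x) (+-identityʳ x′)) (sym (+-identityʳ _))

when-affine : {Q : Set} (d : Dec Q) → ∀ x y z t → (x + 2 * y) + when d (z + 2 * t) ≡ (x + when d z) + 2 * (y + when d t)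
when-affine (yes _) x y z t = affine x y z t
  where
  affine : ∀ x y z t → (x + 2 * y) + (z + 2 * t) ≡ (x + z) + 2 * (y + t)
  affine = solve-∀
when-affine (no _)  x y z t = trans (+-identityʳ _) (sym (cong₂ (λ s u → s + 2 * u) (+-identityʳ x) (+-identityʳ y)))

Σ< : ℕ → (ℕ → ℕ) → ℕ
Σ< zero    f = 0
Σ< (suc n) f = Σ< n f + f n

Σ<-cong : ∀ n {f g} → (∀ j → j < n → f j ≡ g j) → Σ< n f ≡ Σ< n g
Σ<-cong zero    e = refl
Σ<-cong (suc n) e = cong₂ _+_ (Σ<-cong n (λ j j<n → e j (m≤n⇒m≤1+n j<n))) (e n ≤-refl)

Σ<-+ : ∀ n f g → Σ< n (λ j → f j + g j) ≡ Σ< n f + Σ< n g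
Σ<-+ zero    f g = refl
Σ<-+ (suc n) f g = trans (cong (_+ (f n + g n)) (Σ<-+ n f g)) (+-interchange (Σ< n f) (Σ< n g) (f n) (g n))

Σ<-*ˡ : ∀ n c f → Σ< n (λ j → c * f j) ≡ c * Σ< n f
Σ<-*ˡ zero    c f = sym (*-zeroʳ c)
Σ<-*ˡ (suc n) c f = trans (cong (_+ c * f n) (Σ<-*ˡ n c f)) (sym (*-distribˡ-+ c (Σ< n f) (f n)))

Σ<-zero : ∀ n {f} → (∀ j → j < n → f j ≡ 0) → Σ< n f ≡ 0
Σ<-zero zero    e = refl
Σ<-zero (suc n) e = cong₂ _+_ (Σ<-zero n (λ j j<n → e j (m≤n⇒m≤1+n j<n))) (e n ≤-refl)

Σ<-when : {Q : Set} (d : Dec Q) → ∀ n g → Σ< n (λ j → when d (g j)) ≡ when d (Σ< n g)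
Σ<-when (yes _) n g = refl
Σ<-when (no _)  n g = Σ<-zero n (λ _ _ → refl)

Σ<-split : ∀ a n f → Σ< (a + n) f ≡ Σ< a f + Σ< n (λ i → f (a + i))
Σ<-split a zero    f = trans (cong (λ k → Σ< k f) (+-identityʳ a)) (sym (+-identityʳ _))
Σ<-split a (suc n) f = begin
  Σ< (a + suc n) f                                      ≡⟨ cong (λ k → Σ< k f) (+-suc a n) ⟩
  Σ< (a + n) f + f (a + n)                              ≡⟨ cong (_+ f (a + n)) (Σ<-split a n f) ⟩
  Σ< a f + Σ< n (λ i → f (a + i)) + f (a + n)           ≡⟨ +-assoc (Σ< a f) _ _ ⟩
  Σ< a f + Σ< (suc n) (λ i → f (a + i))                 ∎

Σ<-vanishing : ∀ {n n′} f → n ≤ n′ → (∀ j → n ≤ j → f j ≡ 0) → Σ< n′ f ≡ Σ< n f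
Σ<-vanishing {n} {n′} f n≤n′ e = begin
  Σ< n′ f                                     ≡⟨ cong (λ k → Σ< k f) (sym (m+[n∸m]≡n n≤n′)) ⟩
  Σ< (n + (n′ ∸ n)) f                         ≡⟨ Σ<-split n (n′ ∸ n) f ⟩
  Σ< n f + Σ< (n′ ∸ n) (λ i → f (n + i))
    ≡⟨ cong (_+_ (Σ< n f)) (Σ<-zero (n′ ∸ n) (λ i _ → e (n + i) (m≤m+n n i))) ⟩
  Σ< n f + 0                                  ≡⟨ +-identityʳ _ ⟩
  Σ< n f                                      ∎

Σ<-head : ∀ n f → Σ< (suc n) f ≡ f 0 + Σ< n (f ∘ suc)
Σ<-head zero    f = +-comm 0 (f 0)
Σ<-head (suc n) f = trans (cong (_+ f (suc n)) (Σ<-head n f)) (+-assoc (f 0) _ _)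

Σ<-reverse : ∀ n f → Σ< n (λ j → f (n ∸ suc j)) ≡ Σ< n f
Σ<-reverse zero    f = refl
Σ<-reverse (suc n) f = begin
  Σ< (suc n) (λ j → f (suc n ∸ suc j))   ≡⟨ Σ<-head n _ ⟩
  f n + Σ< n (λ j → f (n ∸ suc j))       ≡⟨ cong (_+_ (f n)) (Σ<-reverse n f) ⟩
  f n + Σ< n f                           ≡⟨ +-comm (f n) _ ⟩
  Σ< (suc n) f                           ∎

sum-applyUpTo : ∀ k (g f : ℕ → ℕ) → sum (map f (applyUpTo g k)) ≡ Σ< k (f ∘ g)
sum-applyUpTo zero    g f = refl
sum-applyUpTo (suc k) g f =
  trans (cong (_+_ (f (g 0))) (sum-applyUpTo k (g ∘ suc) f)) (sym (Σ<-head k (f ∘ g)))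

∑≡Σ< : ∀ a b f → ∑ a b f ≡ Σ< (suc b ∸ a) (λ t → f (a + t))
∑≡Σ< a b f = sum-applyUpTo (suc b ∸ a) (_+_ a) f

∑-suc : ∀ n f → ∑ 1 (suc n) f ≡ ∑ 1 n f + f (suc n)
∑-suc n f = trans (∑≡Σ< 1 (suc n) f) (cong (_+ f (suc n)) (sym (∑≡Σ< 1 n f)))

telescope : ∀ (g f : ℕ → ℕ) → (∀ n → g (suc n) ≡ g n + f (suc n)) → ∀ n → g n ≡ g 0 + ∑ 1 n f
telescope g f step zero    = sym (+-identityʳ (g 0))
telescope g f step (suc n) = begin
  g (suc n)                         ≡⟨ step n ⟩
  g n + f (suc n)                   ≡⟨ cong (_+ f (suc n)) (telescope g f step n) ⟩
  g 0 + ∑ 1 n f + f (suc n)         ≡⟨ +-assoc (g 0) _ _ ⟩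
  g 0 + (∑ 1 n f + f (suc n))       ≡⟨ cong (_+_ (g 0)) (sym (∑-suc n f)) ⟩
  g 0 + ∑ 1 (suc n) f               ∎

module _ {B : Set} where

  sum-map-++ : ∀ (f : B → ℕ) xs ys → sum (map f (xs ++ ys)) ≡ sum (map f xs) + sum (map f ys)
  sum-map-++ f xs ys = trans (cong sum (map-++ f xs ys)) (sum-++ (map f xs) (map f ys))

  sum-map-+ : ∀ (f g : B → ℕ) xs → sum (map (λ x → f x + g x) xs) ≡ sum (map f xs) + sum (map g xs)
  sum-map-+ f g []       = refl
  sum-map-+ f g (x ∷ xs) =
    trans (cong (_+_ (f x + g x)) (sum-map-+ f g xs)) (+-interchange (f x) (g x) _ _)

  sum-map-*ˡ : ∀ c (f : B → ℕ) xs → sum (map (λ x → c * f x) xs) ≡ c * sum (map f xs)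
  sum-map-*ˡ c f []       = sym (*-zeroʳ c)
  sum-map-*ˡ c f (x ∷ xs) = trans (cong (_+_ (c * f x)) (sum-map-*ˡ c f xs)) (sym (*-distribˡ-+ c (f x) _))

  sum-map-concatMap : ∀ {A : Set} (f : B → ℕ) (h : A → List B) xs →
    sum (map f (concatMap h xs)) ≡ sum (map (λ x → sum (map f (h x))) xs)
  sum-map-concatMap f h []       = refl
  sum-map-concatMap f h (x ∷ xs) =
    trans (sum-map-++ f (h x) (concatMap h xs)) (cong (_+_ (sum (map f (h x)))) (sum-map-concatMap f h xs))

𝟙 : Bool → ℕ
𝟙 b = if b then 1 else 0

𝟙-∧ : ∀ b c → 𝟙 (b ∧ c) ≡ 𝟙 b * 𝟙 c
𝟙-∧ true  true  = refl
𝟙-∧ true  false = refl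
𝟙-∧ false _     = refl

length-filterᵇ : {B : Set} (p : B → Bool) → ∀ xs → length (filterᵇ p xs) ≡ sum (map (𝟙 ∘ p) xs)
length-filterᵇ p []       = refl
length-filterᵇ p (x ∷ xs) with p x
... | true  = cong suc (length-filterᵇ p xs)
... | false = length-filterᵇ p xs

module _ {A : Set} where

  data Pick : List A → A → List A → Set where
    picked : ∀ {x xs} → Pick (x ∷ xs) x xs
    skip   : ∀ {x xs y r} → Pick xs y r → Pick (x ∷ xs) y (x ∷ r)

  sumPicks : List A → (A → List A → ℕ) → ℕ
  sumPicks []       g = 0
  sumPicks (x ∷ xs) g = g x xs + sumPicks xs (λ y r → g y (x ∷ r))

  sumPicks-cong : ∀ R {g g′ : A → List A → ℕ} → (∀ {y r} → Pick R y r → g y r ≡ g′ y r) →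
    sumPicks R g ≡ sumPicks R g′
  sumPicks-cong []       e = refl
  sumPicks-cong (x ∷ xs) e = cong₂ _+_ (e picked) (sumPicks-cong xs (e ∘ skip))

  sumPicks-const : ∀ R (h : A → ℕ) → sumPicks R (λ y _ → h y) ≡ sum (map h R)
  sumPicks-const []       h = refl
  sumPicks-const (x ∷ xs) h = cong (_+_ (h x)) (sumPicks-const xs h)

  sumPicks-zero : ∀ R {g : A → List A → ℕ} → (∀ {y r} → Pick R y r → g y r ≡ 0) → sumPicks R g ≡ 0
  sumPicks-zero []       e = refl
  sumPicks-zero (x ∷ xs) e = cong₂ _+_ (e picked) (sumPicks-zero xs (e ∘ skip))

  Pick-∈ : ∀ {R y r} → Pick R y r → y ∈ R
  Pick-∈ picked   = here refl
  Pick-∈ (skip p) = there (Pick-∈ p)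

  Pick-⊆ : ∀ {R y r z} → Pick R y r → z ∈ r → z ∈ R
  Pick-⊆ picked   z∈r         = there z∈r
  Pick-⊆ (skip p) (here z≡x)  = here z≡x
  Pick-⊆ (skip p) (there z∈r) = there (Pick-⊆ p z∈r)

  Pick-keep : ∀ {R y r z} → Pick R y r → z ∈ R → z ≢ y → z ∈ r
  Pick-keep picked   (here z≡y)  z≢y = contradiction z≡y z≢y
  Pick-keep picked   (there z∈r) _   = z∈r
  Pick-keep (skip p) (here z≡x)  _   = here z≡x
  Pick-keep (skip p) (there z∈R) z≢y = there (Pick-keep p z∈R z≢y)

  Pick-unique : ∀ {R y r} → Unique R → Pick R y r → Unique r
  Pick-unique (_ ∷ u)     picked   = u
  Pick-unique (x∉ ∷ u) (skip p) = tabulate (λ z∈r → lookup x∉ (Pick-⊆ p z∈r)) ∷ Pick-unique u p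

  Pick-∉ : ∀ {R y r} → Unique R → Pick R y r → y ∉ r
  Pick-∉ u            picked   = Unique.Unique[x∷xs]⇒x∉xs u
  Pick-∉ u@(x∉ ∷ _)   (skip p) (here y≡x)  = Unique.Unique[x∷xs]⇒x∉xs u (subst (_∈ _) y≡x (Pick-∈ p))
  Pick-∉ (_ ∷ u)      (skip p) (there y∈r) = Pick-∉ u p y∈r

  Pick-length : ∀ {R y r} → Pick R y r → length R ≡ suc (length r)
  Pick-length picked   = refl
  Pick-length (skip p) = cong suc (Pick-length p)

  Pick-length-≤ : ∀ {R y r} {F : ℕ} → Pick R y r → length R ≤ suc F → length r ≤ F
  Pick-length-≤ {F = F} pick len = ≤-pred (subst (_≤ suc F) (Pick-length pick) len)

  insertedLater : (List A → ℕ) → A → List A → ℕ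
  insertedLater f x []       = 0
  insertedLater f x (y ∷ ys) = sum (map (f ∘ (y ∷_)) (insertions x ys))

  sum-insertions : ∀ f x σ → sum (map f (insertions x σ)) ≡ f (x ∷ σ) + insertedLater f x σ
  sum-insertions f x []       = refl
  sum-insertions f x (y ∷ ys) = cong (_+_ (f (x ∷ y ∷ ys)) ∘ sum) (sym (map-∘ (insertions x ys)))

  mutual
    sum-perms-∷ : ∀ f x xs →
      sum (map f (perms (x ∷ xs))) ≡ sumPicks (x ∷ xs) (λ y r → sum (map (f ∘ (y ∷_)) (perms r)))
    sum-perms-∷ f x xs = begin
      sum (map f (concatMap (insertions x) (perms xs)))
        ≡⟨ sum-map-concatMap f (insertions x) (perms xs) ⟩
      sum (map (λ σ → sum (map f (insertions x σ))) (perms xs))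
        ≡⟨ cong sum (map-cong (sum-insertions f x) (perms xs)) ⟩
      sum (map (λ σ → f (x ∷ σ) + insertedLater f x σ) (perms xs))
        ≡⟨ sum-map-+ (f ∘ (x ∷_)) (insertedLater f x) (perms xs) ⟩
      sum (map (f ∘ (x ∷_)) (perms xs)) + sum (map (insertedLater f x) (perms xs))
        ≡⟨ cong (_+_ (sum (map (f ∘ (x ∷_)) (perms xs)))) (sum-perms xs (insertedLater f x) refl) ⟩
      sum (map (f ∘ (x ∷_)) (perms xs))
        + sumPicks xs (λ y r → sum (map (insertedLater f x ∘ (y ∷_)) (perms r)))
        ≡⟨ cong (_+_ (sum (map (f ∘ (x ∷_)) (perms xs))))
             (sumPicks-cong xs (λ {y} {r} _ → sym (sum-map-concatMap (f ∘ (y ∷_)) (insertions x) (perms r)))) ⟩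
      sumPicks (x ∷ xs) (λ y r → sum (map (f ∘ (y ∷_)) (perms r)))
        ∎

    sum-perms : ∀ zs f → f [] ≡ 0 →
      sum (map f (perms zs)) ≡ sumPicks zs (λ y r → sum (map (f ∘ (y ∷_)) (perms r)))
    sum-perms []       f f[]≡0 = trans (+-identityʳ (f [])) f[]≡0
    sum-perms (x ∷ xs) f _     = sum-perms-∷ f x xs

insertions-map : ∀ {A B : Set} (f : A → B) x σ → insertions (f x) (map f σ) ≡ map (map f) (insertions x σ)
insertions-map f x []       = refl
insertions-map f x (y ∷ ys) = cong ((f x ∷ f y ∷ map f ys) ∷_) (begin
  map (f y ∷_) (insertions (f x) (map f ys))    ≡⟨ cong (map (f y ∷_)) (insertions-map f x ys) ⟩
  map (f y ∷_) (map (map f) (insertions x ys))  ≡⟨ map-∘ (insertions x ys) ⟨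
  map (map f ∘ (y ∷_)) (insertions x ys)        ≡⟨ map-∘ (insertions x ys) ⟩
  map (map f) (map (y ∷_) (insertions x ys))    ∎)

perms-map : ∀ {A B : Set} (f : A → B) xs → perms (map f xs) ≡ map (map f) (perms xs)
perms-map f []       = refl
perms-map f (x ∷ xs) = begin
  concatMap (insertions (f x)) (perms (map f xs))        ≡⟨ cong (concatMap (insertions (f x))) (perms-map f xs) ⟩
  concatMap (insertions (f x)) (map (map f) (perms xs))  ≡⟨ concatMap-map (insertions (f x)) (map f) (perms xs) ⟩
  concatMap (insertions (f x) ∘ map f) (perms xs)        ≡⟨ concatMap-cong (insertions-map f x) (perms xs) ⟩
  concatMap (map (map f) ∘ insertions x) (perms xs)      ≡⟨ map-concatMap (map f) (insertions x) (perms xs) ⟨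
  map (map f) (concatMap (insertions x) (perms xs))      ∎

sum-indicator-∉ : ∀ c a R → c ∉ R → sum (map (λ y → when (y ≟ c) a) R) ≡ 0
sum-indicator-∉ c a []       _   = refl
sum-indicator-∉ c a (x ∷ xs) c∉R with x ≟ c
... | yes x≡c = contradiction (here (sym x≡c)) c∉R
... | no _    = sum-indicator-∉ c a xs (c∉R ∘ there)

sum-indicator-∈ : ∀ c a R → Unique R → c ∈ R → sum (map (λ y → when (y ≟ c) a) R) ≡ a
sum-indicator-∈ c a (x ∷ xs) u c∈R with x ≟ c | c∈R | u
... | yes refl | _          | x∉ ∷ _ = trans (cong (_+_ a) (sum-indicator-∉ c a xs (Unique.Unique[x∷xs]⇒x∉xs u))) (+-identityʳ a)
... | no x≢c   | here c≡x   | _      = contradiction (sym c≡x) x≢c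
... | no _     | there c∈xs | _ ∷ u′ = sum-indicator-∈ c a xs u′ c∈xs

allowed : List ℤ → ℕ → ℕ → Bool
allowed W i y = ((+ y) - (+ i)) ∈ᵇ W

arrangements : List ℤ → ℕ → List ℕ → ℕ
arrangements W i R = length (filterᵇ (respects W i) (perms R))

module _ (W : List ℤ) where

  arrangements-∷ : ∀ i x xs →
    arrangements W i (x ∷ xs) ≡ sumPicks (x ∷ xs) (λ y r → 𝟙 (allowed W i y) * arrangements W (suc i) r)
  arrangements-∷ i x xs = begin
    arrangements W i (x ∷ xs)
      ≡⟨ length-filterᵇ (respects W i) (perms (x ∷ xs)) ⟩
    sum (map (𝟙 ∘ respects W i) (perms (x ∷ xs)))
      ≡⟨ sum-perms-∷ (𝟙 ∘ respects W i) x xs ⟩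
    sumPicks (x ∷ xs) (λ y r → sum (map (λ τ → 𝟙 (allowed W i y ∧ respects W (suc i) τ)) (perms r)))
      ≡⟨ sumPicks-cong (x ∷ xs) (λ {y} {r} _ → first-step y r) ⟩
    sumPicks (x ∷ xs) (λ y r → 𝟙 (allowed W i y) * arrangements W (suc i) r)
      ∎
    where
    first-step : ∀ y r → sum (map (λ τ → 𝟙 (allowed W i y ∧ respects W (suc i) τ)) (perms r))
                         ≡ 𝟙 (allowed W i y) * arrangements W (suc i) r
    first-step y r = begin
      sum (map (λ τ → 𝟙 (allowed W i y ∧ respects W (suc i) τ)) (perms r))
        ≡⟨ cong sum (map-cong (λ τ → 𝟙-∧ (allowed W i y) (respects W (suc i) τ)) (perms r)) ⟩
      sum (map (λ τ → 𝟙 (allowed W i y) * 𝟙 (respects W (suc i) τ)) (perms r))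
        ≡⟨ sum-map-*ˡ (𝟙 (allowed W i y)) (𝟙 ∘ respects W (suc i)) (perms r) ⟩
      𝟙 (allowed W i y) * sum (map (𝟙 ∘ respects W (suc i)) (perms r))
        ≡⟨ cong (𝟙 (allowed W i y) *_) (sym (length-filterᵇ (respects W (suc i)) (perms r))) ⟩
      𝟙 (allowed W i y) * arrangements W (suc i) r
        ∎

  respects-shift : ∀ k i π → respects W (k + i) (map (_+_ k) π) ≡ respects W i π
  respects-shift k i []       = refl
  respects-shift k i (v ∷ vs) =
    cong₂ _∧_ (cong (_∈ᵇ W) shift-diff)
      (trans (cong (λ j → respects W j (map (_+_ k) vs)) (sym (+-suc k i))) (respects-shift k (suc i) vs))
    where
    shift-diff : (+ (k + v)) - (+ (k + i)) ≡ (+ v) - (+ i)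
    shift-diff = begin
      (+ (k + v)) - (+ (k + i))  ≡⟨ [+m]-[+n]≡m⊖n (k + v) (k + i) ⟩
      (k + v) ⊖ (k + i)          ≡⟨ +-cancelˡ-⊖ k v i ⟩
      v ⊖ i                      ≡⟨ [+m]-[+n]≡m⊖n v i ⟨
      (+ v) - (+ i)              ∎

  arrangements-shift : ∀ k i R → arrangements W (k + i) (map (_+_ k) R) ≡ arrangements W i R
  arrangements-shift k i R = begin
    arrangements W (k + i) (map (_+_ k) R)
      ≡⟨ length-filterᵇ (respects W (k + i)) (perms (map (_+_ k) R)) ⟩
    sum (map (𝟙 ∘ respects W (k + i)) (perms (map (_+_ k) R)))
      ≡⟨ cong (sum ∘ map (𝟙 ∘ respects W (k + i))) (perms-map (_+_ k) R) ⟩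
    sum (map (𝟙 ∘ respects W (k + i)) (map (map (_+_ k)) (perms R)))
      ≡⟨ cong sum (map-∘ (perms R)) ⟨
    sum (map (𝟙 ∘ respects W (k + i) ∘ map (_+_ k)) (perms R))
      ≡⟨ cong sum (map-cong (cong 𝟙 ∘ respects-shift k i) (perms R)) ⟩
    sum (map (𝟙 ∘ respects W i) (perms R))
      ≡⟨ length-filterᵇ (respects W i) (perms R) ⟨
    arrangements W i R
      ∎

Wₘ : ℕ → List ℤ
Wₘ m = -[1+ 1 ] ∷ -[1+ 0 ] ∷ + m ∷ []

data Step (m i y : ℕ) : Set where
  down₂ : 2 + y ≡ i → Step m i y
  down₁ : 1 + y ≡ i → Step m i y
  up    : y ≡ i + m → Step m i y

⊖≡-[1+]⇒ : ∀ y i k → y ⊖ i ≡ -[1+ k ] → suc k + y ≡ i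
⊖≡-[1+]⇒ zero    (suc i) k refl = +-identityʳ (suc i)
⊖≡-[1+]⇒ (suc y) (suc i) k eq   =
  trans (+-suc (suc k) y) (cong suc (⊖≡-[1+]⇒ y i k (trans (sym ([1+m]⊖[1+n]≡m⊖n y i)) eq)))

⊖≡+⇒ : ∀ y i k → y ⊖ i ≡ + k → y ≡ i + k
⊖≡+⇒ zero    zero    k refl = refl
⊖≡+⇒ (suc y) zero    k refl = refl
⊖≡+⇒ (suc y) (suc i) k eq   = cong suc (⊖≡+⇒ y i k (trans (sym ([1+m]⊖[1+n]≡m⊖n y i)) eq))

+-diff-below : ∀ y k → (+ y) - (+ (suc k + y)) ≡ -[1+ k ]
+-diff-below y k = begin
  (+ y) - (+ (suc k + y))  ≡⟨ [+m]-[+n]≡m⊖n y (suc k + y) ⟩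
  y ⊖ (suc k + y)          ≡⟨ cong₂ _⊖_ (sym (+-identityʳ y)) (+-comm (suc k) y) ⟩
  (y + 0) ⊖ (y + suc k)    ≡⟨ +-cancelˡ-⊖ y 0 (suc k) ⟩
  -[1+ k ]                 ∎

+-diff-above : ∀ i k → (+ (i + k)) - (+ i) ≡ + k
+-diff-above i k = begin
  (+ (i + k)) - (+ i)  ≡⟨ [+m]-[+n]≡m⊖n (i + k) i ⟩
  (i + k) ⊖ i          ≡⟨ cong ((i + k) ⊖_) (sym (+-identityʳ i)) ⟩
  (i + k) ⊖ (i + 0)    ≡⟨ +-cancelˡ-⊖ i k 0 ⟩
  + k                  ∎

module _ (m : ℕ) where

  allowed⇒Step : ∀ i y → allowed (Wₘ m) i y ≡ true → Step m i y
  allowed⇒Step i y eq with (+ y) - (+ i) ℤ.≟ -[1+ 1 ] | (+ y) - (+ i) ℤ.≟ -[1+ 0 ] | (+ y) - (+ i) ℤ.≟ + m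
  ... | yes d | _     | _     = down₂ (⊖≡-[1+]⇒ y i 1 (trans (sym ([+m]-[+n]≡m⊖n y i)) d))
  ... | no _  | yes d | _     = down₁ (⊖≡-[1+]⇒ y i 0 (trans (sym ([+m]-[+n]≡m⊖n y i)) d))
  ... | no _  | no _  | yes d = up (⊖≡+⇒ y i m (trans (sym ([+m]-[+n]≡m⊖n y i)) d))
  allowed⇒Step i y () | no _ | no _ | no _

  Step⇒allowed : ∀ {i y} → Step m i y → allowed (Wₘ m) i y ≡ true
  Step⇒allowed {y = y} (down₂ refl) rewrite +-diff-below y 1 = refl
  Step⇒allowed {y = y} (down₁ refl) rewrite +-diff-below y 0 = refl
  Step⇒allowed {i = i} (up refl)    rewrite +-diff-above i m | dec-true (+ m ℤ.≟ + m) refl = refl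

  𝟙-allowed-* : ∀ i {y} → Step m i y → ∀ x → 𝟙 (allowed (Wₘ m) i y) * x ≡ x
  𝟙-allowed-* i s x = trans (cong (λ b → 𝟙 b * x) (Step⇒allowed s)) (*-identityˡ x)

  𝟙-disallowed : ∀ i y → ¬ Step m i y → 𝟙 (allowed (Wₘ m) i y) ≡ 0
  𝟙-disallowed i y ¬s with allowed (Wₘ m) i y in eq
  ... | true  = contradiction (allowed⇒Step i y eq) ¬s
  ... | false = refl

⊓<⊔ : ∀ x v → x ≢ v → x ⊓ v < x ⊔ v
⊓<⊔ x v x≢v with ≤-total x v
... | inj₁ x≤v rewrite m≤n⇒m⊓n≡m x≤v | m≤n⇒m⊔n≡n x≤v = ≤∧≢⇒< x≤v x≢v
... | inj₂ v≤x rewrite m≥n⇒m⊓n≡n v≤x | m≥n⇒m⊔n≡m v≤x = ≤∧≢⇒< v≤x (x≢v ∘ sym)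

≢-⊓⊔ : ∀ {z} a q → z ≢ a → z ≢ q → z ≢ a ⊓ q × z ≢ a ⊔ q
≢-⊓⊔ a q z≢a z≢q with ≤-total a q
... | inj₁ a≤q rewrite m≤n⇒m⊓n≡m a≤q | m≤n⇒m⊔n≡n a≤q = z≢a , z≢q
... | inj₂ q≤a rewrite m≥n⇒m⊓n≡n q≤a | m≥n⇒m⊔n≡m q≤a = z≢q , z≢a

⊓⊔-≢ : ∀ {z} a q → z ≢ a ⊓ q → z ≢ a ⊔ q → z ≢ a × z ≢ q
⊓⊔-≢ a q z≢⊓ z≢⊔ with ≤-total a q
... | inj₁ a≤q rewrite m≤n⇒m⊓n≡m a≤q | m≤n⇒m⊔n≡n a≤q = z≢⊓ , z≢⊔
... | inj₂ q≤a rewrite m≥n⇒m⊓n≡n q≤a | m≥n⇒m⊔n≡m q≤a = z≢⊔ , z≢⊓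

∸-suc : ∀ {n T} → n < T → T ∸ n ≡ suc (T ∸ suc n)
∸-suc {zero}  {suc T} _         = refl
∸-suc {suc n} {suc T} (s≤s n<T) = ∸-suc n<T

module _ (m : ℕ) where

  -- completions (T ∸ p) (T ∸ q), for p < q ≤ T, counts the ways to fill the positions from
  -- p + 2 on with the remaining values when, among the values p, …, T, exactly p and q are
  -- used. Position p + 2 takes p + 1 (a step −1) or p + 2 + m (a step m); the steps −2 that
  -- are then forced below the smaller used value involve no choice. The fuel f only ensures
  -- termination.
  completionsᶠ : ℕ → ℕ → ℕ → ℕ
  completionsᶠ zero    _             _ = 0
  completionsᶠ (suc f) zero          _ = 1
  completionsᶠ (suc f) (suc zero)    _ = 1
  completionsᶠ (suc f) (suc (suc w)) v =
    unless (suc w ≟ v) (completionsᶠ f (suc w) v)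
    + when (m ≤? w) (unless (w ∸ m ≟ v) (completionsᶠ f ((w ∸ m) ⊔ v) ((w ∸ m) ⊓ v)))

  completions : ℕ → ℕ → ℕ
  completions u v = completionsᶠ (suc u) u v

  completionsᶠ-fuel : ∀ f g u v → v < u → u < f → u < g → completionsᶠ f u v ≡ completionsᶠ g u v
  completionsᶠ-fuel (suc f) (suc g) zero          v _   _          _          = refl
  completionsᶠ-fuel (suc f) (suc g) (suc zero)    v _   _          _          = refl
  completionsᶠ-fuel (suc f) (suc g) (suc (suc w)) v v<u (s≤s u<f) (s≤s u<g) =
    cong₂ _+_
      (unless-cong (suc w ≟ v) λ w+1≢v →
        completionsᶠ-fuel f g (suc w) v (≤∧≢⇒< (≤-pred v<u) (w+1≢v ∘ sym)) u<f u<g)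
      (when-cong (m ≤? w) λ _ → unless-cong (w ∸ m ≟ v) λ w∸m≢v →
        completionsᶠ-fuel f g _ _ (⊓<⊔ (w ∸ m) v w∸m≢v) (<-≤-trans max<2+w u<f) (<-≤-trans max<2+w u<g))
    where
    max<2+w : (w ∸ m) ⊔ v < suc (suc w)
    max<2+w = s≤s (⊔-lub (≤-trans (m∸n≤m w m) (n≤1+n w)) (≤-pred v<u))

  completions-≤1 : ∀ u v → u ≤ 1 → completions u v ≡ 1
  completions-≤1 zero       v _ = refl
  completions-≤1 (suc zero) v _ = refl
  completions-≤1 (suc (suc u)) v (s≤s ())

  completions-unfold : ∀ w v → v < suc (suc w) →
    completions (suc (suc w)) v
      ≡ unless (suc w ≟ v) (completions (suc w) v)
        + when (m ≤? w) (unless (w ∸ m ≟ v) (completions ((w ∸ m) ⊔ v) ((w ∸ m) ⊓ v)))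
  completions-unfold w v v<u = cong (_+_ (unless (suc w ≟ v) (completions (suc w) v)))
    (when-cong (m ≤? w) λ _ → unless-cong (w ∸ m ≟ v) λ w∸m≢v →
      completionsᶠ-fuel _ _ _ _ (⊓<⊔ (w ∸ m) v w∸m≢v)
        (s≤s (⊔-lub (≤-trans (m∸n≤m w m) (n≤1+n w)) (≤-pred v<u))) (n<1+n _))

  completions-unfold-at : ∀ p q T → p < q → q ≤ T → 2 + p ≤ T →
    completions (T ∸ p) (T ∸ q)
      ≡ unless (suc p ≟ q) (completions (T ∸ suc p) (T ∸ q))
        + when (2 + p + m ≤? T) (unless (2 + p + m ≟ q) (completions (T ∸ ((2 + p + m) ⊓ q)) (T ∸ ((2 + p + m) ⊔ q))))
  completions-unfold-at p q T p<q q≤T 2+p≤T = begin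
    completions (T ∸ p) (T ∸ q)
      ≡⟨ cong (λ u → completions u (T ∸ q)) T∸p≡2+w ⟩
    completions (suc (suc w)) (T ∸ q)
      ≡⟨ completions-unfold w (T ∸ q) (subst (T ∸ q <_) T∸p≡2+w (∸-monoʳ-< p<q q≤T)) ⟩
    unless (suc w ≟ T ∸ q) (completions (suc w) (T ∸ q))
      + when (m ≤? w) (unless (w ∸ m ≟ T ∸ q) (completions ((w ∸ m) ⊔ (T ∸ q)) ((w ∸ m) ⊓ (T ∸ q))))
      ≡⟨ cong₂ _+_ down-step up-step ⟩
    unless (suc p ≟ q) (completions (T ∸ suc p) (T ∸ q))
      + when (a ≤? T) (unless (a ≟ q) (completions (T ∸ (a ⊓ q)) (T ∸ (a ⊔ q))))
      ∎
    where
    w = T ∸ (2 + p)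
    a = 2 + p + m
    1+p≤T : suc p ≤ T
    1+p≤T = ≤-trans (n≤1+n _) 2+p≤T
    T∸1+p≡1+w : T ∸ suc p ≡ suc w
    T∸1+p≡1+w = ∸-suc 2+p≤T
    T∸p≡2+w : T ∸ p ≡ suc (suc w)
    T∸p≡2+w = trans (∸-suc 1+p≤T) (cong suc T∸1+p≡1+w)
    w∸m≡T∸a : w ∸ m ≡ T ∸ a
    w∸m≡T∸a = ∸-+-assoc T (2 + p) m
    m≤w⇒a≤T : m ≤ w → a ≤ T
    m≤w⇒a≤T m≤w = subst (a ≤_) (m+[n∸m]≡n 2+p≤T) (+-monoʳ-≤ (2 + p) m≤w)
    a≤T⇒m≤w : a ≤ T → m ≤ w
    a≤T⇒m≤w a≤T = subst (_≤ w) (m+n∸m≡n (2 + p) m) (∸-monoˡ-≤ (2 + p) a≤T)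
    down-step : unless (suc w ≟ T ∸ q) (completions (suc w) (T ∸ q))
              ≡ unless (suc p ≟ q) (completions (T ∸ suc p) (T ∸ q))
    down-step = begin
      unless (suc w ≟ T ∸ q) (completions (suc w) (T ∸ q))
        ≡⟨ cong (λ u → unless (u ≟ T ∸ q) (completions u (T ∸ q))) (sym T∸1+p≡1+w) ⟩
      unless (T ∸ suc p ≟ T ∸ q) (completions (T ∸ suc p) (T ∸ q))
        ≡⟨ unless-iff (T ∸ suc p ≟ T ∸ q) (suc p ≟ q) (∸-cancelˡ-≡ 1+p≤T q≤T) (cong (T ∸_)) ⟩
      unless (suc p ≟ q) (completions (T ∸ suc p) (T ∸ q))
        ∎
    up-step : when (m ≤? w) (unless (w ∸ m ≟ T ∸ q) (completions ((w ∸ m) ⊔ (T ∸ q)) ((w ∸ m) ⊓ (T ∸ q))))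
            ≡ when (a ≤? T) (unless (a ≟ q) (completions (T ∸ (a ⊓ q)) (T ∸ (a ⊔ q))))
    up-step = begin
      when (m ≤? w) (unless (w ∸ m ≟ T ∸ q) (completions ((w ∸ m) ⊔ (T ∸ q)) ((w ∸ m) ⊓ (T ∸ q))))
        ≡⟨ cong (λ x → when (m ≤? w) (unless (x ≟ T ∸ q) (completions (x ⊔ (T ∸ q)) (x ⊓ (T ∸ q))))) w∸m≡T∸a ⟩
      when (m ≤? w) (unless (T ∸ a ≟ T ∸ q) (completions ((T ∸ a) ⊔ (T ∸ q)) ((T ∸ a) ⊓ (T ∸ q))))
        ≡⟨ cong (λ x → when (m ≤? w) (unless (T ∸ a ≟ T ∸ q) x))
             (sym (cong₂ completions (∸-distribˡ-⊓-⊔ T a q) (∸-distribˡ-⊔-⊓ T a q))) ⟩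
      when (m ≤? w) (unless (T ∸ a ≟ T ∸ q) (completions (T ∸ (a ⊓ q)) (T ∸ (a ⊔ q))))
        ≡⟨ when-cong (m ≤? w) (λ m≤w →
             unless-iff (T ∸ a ≟ T ∸ q) (a ≟ q) (∸-cancelˡ-≡ (m≤w⇒a≤T m≤w) q≤T) (cong (T ∸_))) ⟩
      when (m ≤? w) (unless (a ≟ q) (completions (T ∸ (a ⊓ q)) (T ∸ (a ⊔ q))))
        ≡⟨ when-iff (m ≤? w) (a ≤? T) m≤w⇒a≤T a≤T⇒m≤w ⟩
      when (a ≤? T) (unless (a ≟ q) (completions (T ∸ (a ⊓ q)) (T ∸ (a ⊔ q))))
        ∎

Free : ℕ → ℕ → ℕ → ℕ → ℕ → Set
Free t p q T z = t ≤ z × z ≤ T × z ≢ p × z ≢ q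

-- The state before position 2 + t (values are shifted up by 2, so that the value
-- "position − 2" is always a natural number): among the values t, …, T, the two values
-- p and q have already been used by up-steps, every value below t is used, and R lists
-- the unused ones.
record Holes (t p q T : ℕ) (R : List ℕ) : Set where
  field
    t≤p      : t ≤ p
    p<q      : p < q
    q≤T      : q ≤ T
    unique   : Unique R
    sound    : ∀ {z} → z ∈ R → Free t p q T z
    complete : ∀ {z} → Free t p q T z → z ∈ R

module _ {t p q T : ℕ} {R : List ℕ} (H : Holes t p q T R) where
  open Holes H

  Holes-pick-low : ∀ {r} → t < p → Pick R t r → Holes (suc t) p q T r
  Holes-pick-low t<p pick = record
    { t≤p = t<p ; p<q = p<q ; q≤T = q≤T ; unique = Pick-unique unique pick
    ; sound = λ z∈r → let (t≤z , z≤T , z≢p , z≢q) = sound (Pick-⊆ pick z∈r)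
                      in ≤∧≢⇒< t≤z (λ t≡z → Pick-∉ unique pick (subst (_∈ _) (sym t≡z) z∈r)) , z≤T , z≢p , z≢q
    ; complete = λ (t<z , z≤T , z≢p , z≢q) → Pick-keep pick (complete (<⇒≤ t<z , z≤T , z≢p , z≢q)) (<⇒≢ t<z ∘ sym)
    }

module _ {p q T : ℕ} {R : List ℕ} (H : Holes p p q T R) where
  open Holes H

  Holes-∈⇒2+p≤T : ∀ {x} → x ∈ R → 2 + p ≤ T
  Holes-∈⇒2+p≤T x∈R with sound x∈R
  ... | p≤x , x≤T , x≢p , x≢q with m≤n⇒m<n∨m≡n (≤∧≢⇒< p≤x (x≢p ∘ sym))
  ...   | inj₁ 1+p<x = ≤-trans 1+p<x x≤T
  ...   | inj₂ 1+p≡x = <-≤-trans (≤∧≢⇒< p<q (λ 1+p≡q → x≢q (trans (sym 1+p≡x) 1+p≡q))) q≤T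

  Holes-pick-next : ∀ {r} → Pick R (suc p) r → Holes (suc p) (suc p) q T r
  Holes-pick-next pick = record
    { t≤p = ≤-refl
    ; p<q = let (_ , _ , _ , 1+p≢q) = sound (Pick-∈ pick) in ≤∧≢⇒< p<q 1+p≢q
    ; q≤T = q≤T ; unique = Pick-unique unique pick
    ; sound = λ z∈r → let (p≤z , z≤T , z≢p , z≢q) = sound (Pick-⊆ pick z∈r)
                      in ≤∧≢⇒< p≤z (z≢p ∘ sym) , z≤T
                       , (λ z≡1+p → Pick-∉ unique pick (subst (_∈ _) z≡1+p z∈r)) , z≢q
    ; complete = λ (p<z , z≤T , z≢1+p , z≢q) → Pick-keep pick (complete (<⇒≤ p<z , z≤T , <⇒≢ p<z ∘ sym , z≢q)) z≢1+p
    }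

  Holes-pick-up : ∀ {a r} → p < a → Pick R a r → Holes (suc p) (a ⊓ q) (a ⊔ q) T r
  Holes-pick-up {a} p<a pick = record
    { t≤p = ⊓-glb p<a p<q
    ; p<q = ⊓<⊔ a q a≢q
    ; q≤T = ⊔-lub a≤T q≤T
    ; unique = Pick-unique unique pick
    ; sound = λ z∈r → let (p≤z , z≤T , z≢p , z≢q) = sound (Pick-⊆ pick z∈r)
                          z≢a = λ z≡a → Pick-∉ unique pick (subst (_∈ _) z≡a z∈r)
                          (z≢⊓ , z≢⊔) = ≢-⊓⊔ a q z≢a z≢q
                      in ≤∧≢⇒< p≤z (z≢p ∘ sym) , z≤T , z≢⊓ , z≢⊔
    ; complete = λ (p<z , z≤T , z≢⊓ , z≢⊔) → let (z≢a , z≢q) = ⊓⊔-≢ a q z≢⊓ z≢⊔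
                 in Pick-keep pick (complete (<⇒≤ p<z , z≤T , <⇒≢ p<z ∘ sym , z≢q)) z≢a
    }
    where
    a∈R = Pick-∈ pick
    a≤T : a ≤ T
    a≤T = let (_ , a≤T , _ , _) = sound a∈R in a≤T
    a≢q : a ≢ q
    a≢q = let (_ , _ , _ , a≢q) = sound a∈R in a≢q

module _ (m : ℕ) where

  private
    arr = arrangements (Wₘ m)

  arrangements-stuck : ∀ F i R z → length R ≤ F → z ∈ R → 2 + z < i → arr i R ≡ 0
  arrangements-stuck zero    i (x ∷ xs) z ()  _   _
  arrangements-stuck (suc F) i (x ∷ xs) z len z∈R 2+z<i =
    trans (arrangements-∷ (Wₘ m) i x xs) (sumPicks-zero (x ∷ xs) vanishes)
    where
    vanishes : ∀ {y r} → Pick (x ∷ xs) y r → 𝟙 (allowed (Wₘ m) i y) * arr (suc i) r ≡ 0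
    vanishes {y} {r} pick with y ≟ z
    ... | yes refl = cong (_* arr (suc i) r) (𝟙-disallowed m i y λ
          { (down₂ 2+y≡i) → <-irrefl 2+y≡i 2+z<i
          ; (down₁ 1+y≡i) → <-asym (subst (_< 2 + y) 1+y≡i (n<1+n _)) 2+z<i
          ; (up y≡i+m)    → <⇒≱ 2+z<i (≤-trans (m≤m+n i m) (≤-trans (≤-reflexive (sym y≡i+m)) (m≤n+m y 2))) })
    ... | no y≢z   = trans (cong (𝟙 (allowed (Wₘ m) i y) *_)
                       (arrangements-stuck F (suc i) r z (Pick-length-≤ pick len)
                          (Pick-keep pick z∈R (y≢z ∘ sym)) (m≤n⇒m≤1+n 2+z<i)))
                       (*-zeroʳ (𝟙 (allowed (Wₘ m) i y)))

  ArrangementsAgree : ℕ → Set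
  ArrangementsAgree F = ∀ {t p q T R} → length R ≤ F → Holes t p q T R → arr (2 + t) R ≡ completions m (T ∸ p) (T ∸ q)

  arrangements-[] : ∀ {t p q T} → Holes t p q T [] → arr (2 + t) [] ≡ completions m (T ∸ p) (T ∸ q)
  arrangements-[] {t} {p} {q} {T} H = sym (completions-≤1 m (T ∸ p) (T ∸ q) T∸p≤1)
    where
    open Holes H
    T∸p≤1 : T ∸ p ≤ 1
    T∸p≤1 with 2 + p ≤? T | suc p ≟ q
    ... | no 2+p≰T | _       = subst (T ∸ p ≤_) (m+n∸n≡m 1 p) (∸-monoˡ-≤ p (≤-pred (≰⇒> 2+p≰T)))
    ... | yes 2+p≤T | yes 1+p≡q =
      contradiction (complete (≤-trans t≤p (m≤n+m p 2) , 2+p≤T , m≢1+n+m p ∘ sym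
                              , λ 2+p≡q → 1+n≢n (trans 2+p≡q (sym 1+p≡q))))
                    ¬Any[]
    ... | yes 2+p≤T | no 1+p≢q  =
      contradiction (complete (≤-trans t≤p (n≤1+n p) , ≤-trans (n≤1+n _) 2+p≤T , 1+n≢n , 1+p≢q)) ¬Any[]

  arrangements-fill : ∀ {F t p q T x xs} → ArrangementsAgree F → t < p → length (x ∷ xs) ≤ suc F →
    Holes t p q T (x ∷ xs) → arr (2 + t) (x ∷ xs) ≡ completions m (T ∸ p) (T ∸ q)
  arrangements-fill {F} {t} {p} {q} {T} {x} {xs} ih t<p len H = begin
    arr (2 + t) (x ∷ xs)
      ≡⟨ arrangements-∷ (Wₘ m) (2 + t) x xs ⟩
    sumPicks (x ∷ xs) (λ y r → 𝟙 (allowed (Wₘ m) (2 + t) y) * arr (3 + t) r)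
      ≡⟨ sumPicks-cong (x ∷ xs) forced ⟩
    sumPicks (x ∷ xs) (λ y _ → when (y ≟ t) X)
      ≡⟨ sumPicks-const (x ∷ xs) (λ y → when (y ≟ t) X) ⟩
    sum (map (λ y → when (y ≟ t) X) (x ∷ xs))
      ≡⟨ sum-indicator-∈ t X (x ∷ xs) unique t∈R ⟩
    X ∎
    where
    open Holes H
    X = completions m (T ∸ p) (T ∸ q)
    t∈R : t ∈ x ∷ xs
    t∈R = complete (≤-refl , ≤-trans (<⇒≤ (<-trans t<p p<q)) q≤T , <⇒≢ t<p , <⇒≢ (<-trans t<p p<q))
    -- The value t can only be placed at position 2 + t, so that is where it goes.
    forced : ∀ {y r} → Pick (x ∷ xs) y r → 𝟙 (allowed (Wₘ m) (2 + t) y) * arr (3 + t) r ≡ when (y ≟ t) X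
    forced {y} {r} pick with y ≟ t
    ... | yes refl = trans (𝟙-allowed-* m (2 + t) (down₂ refl) _) (ih (Pick-length-≤ pick len) (Holes-pick-low H t<p pick))
    ... | no y≢t   = trans (cong (𝟙 (allowed (Wₘ m) (2 + t) y) *_)
                       (arrangements-stuck F (3 + t) r t (Pick-length-≤ pick len) (Pick-keep pick t∈R (y≢t ∘ sym)) ≤-refl))
                       (*-zeroʳ (𝟙 (allowed (Wₘ m) (2 + t) y)))

  arrangements-branch : ∀ {F p q T x xs} → ArrangementsAgree F → length (x ∷ xs) ≤ suc F →
    Holes p p q T (x ∷ xs) → arr (2 + p) (x ∷ xs) ≡ completions m (T ∸ p) (T ∸ q)
  arrangements-branch {F} {p} {q} {T} {x} {xs} ih len H = begin
    arr (2 + p) R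
      ≡⟨ arrangements-∷ (Wₘ m) (2 + p) x xs ⟩
    sumPicks R (λ y r → 𝟙 (allowed (Wₘ m) (2 + p) y) * arr (3 + p) r)
      ≡⟨ sumPicks-cong R choice ⟩
    sumPicks R (λ y _ → when (y ≟ suc p) X₁ + when (y ≟ a) X₂)
      ≡⟨ sumPicks-const R (λ y → when (y ≟ suc p) X₁ + when (y ≟ a) X₂) ⟩
    sum (map (λ y → when (y ≟ suc p) X₁ + when (y ≟ a) X₂) R)
      ≡⟨ sum-map-+ (λ y → when (y ≟ suc p) X₁) (λ y → when (y ≟ a) X₂) R ⟩
    sum (map (λ y → when (y ≟ suc p) X₁) R) + sum (map (λ y → when (y ≟ a) X₂) R)
      ≡⟨ cong₂ _+_ down-count up-count ⟩
    unless (suc p ≟ q) X₁ + when (a ≤? T) (unless (a ≟ q) X₂)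
      ≡⟨ completions-unfold-at m p q T p<q q≤T 2+p≤T ⟨
    completions m (T ∸ p) (T ∸ q) ∎
    where
    open Holes H
    R = x ∷ xs
    a = 2 + p + m
    X₁ = completions m (T ∸ suc p) (T ∸ q)
    X₂ = completions m (T ∸ (a ⊓ q)) (T ∸ (a ⊔ q))
    2+p≤T : 2 + p ≤ T
    2+p≤T = Holes-∈⇒2+p≤T H (here refl)
    p<a : p < a
    p<a = ≤-trans (n≤1+n _) (m≤m+n (2 + p) m)
    choice : ∀ {y r} → Pick R y r → 𝟙 (allowed (Wₘ m) (2 + p) y) * arr (3 + p) r ≡ when (y ≟ suc p) X₁ + when (y ≟ a) X₂
    choice {y} {r} pick with y ≟ suc p | y ≟ a
    ... | yes refl | yes 1+p≡a = contradiction 1+p≡a (<⇒≢ (s≤s (m≤m+n (suc p) m)))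
    ... | yes refl | no _      = trans (𝟙-allowed-* m (2 + p) (down₁ refl) _)
                                   (trans (ih (Pick-length-≤ pick len) (Holes-pick-next H pick)) (sym (+-identityʳ X₁)))
    ... | no _     | yes refl  = trans (𝟙-allowed-* m (2 + p) (up refl) _) (ih (Pick-length-≤ pick len) (Holes-pick-up H p<a pick))
    ... | no y≢1+p | no y≢a    = cong (_* arr (3 + p) r) (𝟙-disallowed m (2 + p) y λ
          { (down₂ 2+y≡2+p) → let (_ , _ , y≢p , _) = sound (Pick-∈ pick) in y≢p (+-cancelˡ-≡ 2 y p 2+y≡2+p)
          ; (down₁ 1+y≡2+p) → y≢1+p (suc-injective 1+y≡2+p)
          ; (up y≡a)        → y≢a y≡a })
    down-count : sum (map (λ y → when (y ≟ suc p) X₁) R) ≡ unless (suc p ≟ q) X₁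
    down-count with suc p ≟ q
    ... | yes 1+p≡q = sum-indicator-∉ (suc p) X₁ R (λ 1+p∈R → let (_ , _ , _ , 1+p≢q) = sound 1+p∈R in 1+p≢q 1+p≡q)
    ... | no 1+p≢q  = sum-indicator-∈ (suc p) X₁ R unique (complete (n≤1+n p , ≤-trans (n≤1+n _) 2+p≤T , 1+n≢n , 1+p≢q))
    up-count : sum (map (λ y → when (y ≟ a) X₂) R) ≡ when (a ≤? T) (unless (a ≟ q) X₂)
    up-count with a ≤? T
    ... | no a≰T = sum-indicator-∉ a X₂ R (λ a∈R → let (_ , a≤T , _ , _) = sound a∈R in a≰T a≤T)
    ... | yes a≤T with a ≟ q
    ...   | yes a≡q = sum-indicator-∉ a X₂ R (λ a∈R → let (_ , _ , _ , a≢q) = sound a∈R in a≢q a≡q)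
    ...   | no a≢q  = sum-indicator-∈ a X₂ R unique (complete (<⇒≤ p<a , a≤T , <⇒≢ p<a ∘ sym , a≢q))

  arrangements≡completions : ∀ F → ArrangementsAgree F
  arrangements≡completions F       {R = []}     _   H = arrangements-[] H
  arrangements≡completions zero    {R = x ∷ xs} ()  H
  arrangements≡completions (suc F) {R = x ∷ xs} len H with m≤n⇒m<n∨m≡n (Holes.t≤p H)
  ... | inj₁ t<p  = arrangements-fill (arrangements≡completions F) t<p len H
  ... | inj₂ refl = arrangements-branch (arrangements≡completions F) len H

  P≡completions : ∀ n → P n (Wₘ m) ≡ completions m (suc n) n
  P≡completions n = begin
    P n (Wₘ m)                          ≡⟨ arrangements-shift (Wₘ m) 2 0 (upTo n) ⟨
    arr 2 (map (_+_ 2) (upTo n))        ≡⟨ arrangements≡completions _ ≤-refl initial ⟩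
    completions m (suc n) n             ∎
    where
    initial : Holes 0 0 1 (suc n) (map (_+_ 2) (upTo n))
    initial = record
      { t≤p = z≤n ; p<q = s≤s z≤n ; q≤T = s≤s z≤n
      ; unique = Unique.map⁺ (suc-injective ∘ suc-injective) (Unique.upTo⁺ n)
      ; sound = sound ; complete = complete }
      where
      sound : ∀ {z} → z ∈ map (_+_ 2) (upTo n) → Free 0 0 1 (suc n) z
      sound z∈R with ∈-map⁻ (_+_ 2) z∈R
      ... | i , i∈upTo , refl = z≤n , s≤s (∈-upTo⁻ i∈upTo) , (λ ()) , (λ ())
      complete : ∀ {z} → Free 0 0 1 (suc n) z → z ∈ map (_+_ 2) (upTo n)
      complete {zero}          (_ , _ , z≢0 , _) = contradiction refl z≢0
      complete {suc zero}      (_ , _ , _ , z≢1) = contradiction refl z≢1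
      complete {suc (suc i)}   (_ , s≤s i<n , _ , _) = ∈-map⁺ (_+_ 2) (∈-upTo⁺ i<n)

-- lag a x d = a (x - d), read as 0 when d > x.
lag : (ℕ → ℕ) → ℕ → ℕ → ℕ
lag a x       zero    = a x
lag a zero    (suc d) = 0
lag a (suc x) (suc d) = lag a x d

module _ (a : ℕ → ℕ) where

  lag-< : ∀ x d → x < d → lag a x d ≡ 0
  lag-< zero    (suc d) _         = refl
  lag-< (suc x) (suc d) (s≤s x<d) = lag-< x d x<d

  lag-≤ : ∀ x d → d ≤ x → lag a x d ≡ a (x ∸ d)
  lag-≤ x       zero    _         = refl
  lag-≤ (suc x) (suc d) (s≤s d≤x) = lag-≤ x d d≤x

  lag-+ : ∀ k y d → lag a (k + y) (k + d) ≡ lag a y d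
  lag-+ zero    y d = refl
  lag-+ (suc k) y d = lag-+ k y d

  lag-self : ∀ x → lag a x x ≡ a 0
  lag-self zero    = refl
  lag-self (suc x) = lag-self x

module Recurrence (m : ℕ) (a : ℕ → ℕ) (a-zero : a 0 ≡ 1)
                (a-suc : ∀ x → a (suc x) ≡ a x + lag a (suc x) (m + 2)) where

  lag-suc : ∀ x d → d ≤ x → lag a (suc x) d ≡ lag a x d + lag a (suc x) (d + (m + 2))
  lag-suc x       zero    _         = a-suc x
  lag-suc (suc x) (suc d) (s≤s d≤x) = lag-suc x d d≤x

  lag-far : ∀ w d → lag a (2 + w) (d + (m + 2)) ≡ when (m ≤? w) (lag a (w ∸ m) d)
  lag-far w d with m ≤? w
  ... | yes m≤w = begin
    lag a (2 + w) (d + (m + 2))                  ≡⟨ cong₂ (lag a) 2+w≡ (+-comm d (m + 2)) ⟩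
    lag a ((m + 2) + (w ∸ m)) ((m + 2) + d)      ≡⟨ lag-+ a (m + 2) (w ∸ m) d ⟩
    lag a (w ∸ m) d                              ∎
    where
    2+w≡ : 2 + w ≡ (m + 2) + (w ∸ m)
    2+w≡ = trans (cong (_+_ 2) (sym (m+[n∸m]≡n m≤w))) (trans (sym (+-assoc 2 m (w ∸ m))) (cong (_+ (w ∸ m)) (+-comm 2 m)))
  ... | no m≰w  = lag-< a (2 + w) (d + (m + 2))
    (<-≤-trans (+-monoʳ-< 2 (≰⇒> m≰w)) (subst (_≤ d + (m + 2)) (+-comm m 2) (m≤n+m (m + 2) d)))

  Pᵗ : ℕ → ℕ
  Pᵗ j = completions m (suc j) j

  Pᵗ-suc : ∀ k → Pᵗ (suc k) ≡ when (m ≤? k) (completions m (suc k) (k ∸ m))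
  Pᵗ-suc k = trans (completions-unfold m k (suc k) ≤-refl) (cong₂ _+_ no-down (when-cong (m ≤? k) (λ _ → up-step)))
    where
    k∸m≤1+k : k ∸ m ≤ suc k
    k∸m≤1+k = ≤-trans (m∸n≤m k m) (n≤1+n k)
    no-down : unless (suc k ≟ suc k) (completions m (suc k) (suc k)) ≡ 0
    no-down with suc k ≟ suc k
    ... | yes _  = refl
    ... | no 1+k≢1+k = contradiction refl 1+k≢1+k
    up-step : unless (k ∸ m ≟ suc k) (completions m ((k ∸ m) ⊔ suc k) ((k ∸ m) ⊓ suc k)) ≡ completions m (suc k) (k ∸ m)
    up-step with k ∸ m ≟ suc k
    ... | yes k∸m≡1+k = contradiction k∸m≡1+k (<⇒≢ (s≤s (m∸n≤m k m)))
    ... | no _        = cong₂ (completions m) (m≤n⇒m⊔n≡n k∸m≤1+k) (m≤n⇒m⊓n≡m k∸m≤1+k)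

  Pᵗ-small : ∀ j → j < m → Pᵗ (suc j) ≡ 0
  Pᵗ-small j j<m = trans (Pᵗ-suc j) (vanish (m ≤? j))
    where
    vanish : (d : Dec (m ≤ j)) → when d (completions m (suc j) (j ∸ m)) ≡ 0
    vanish (yes m≤j) = contradiction m≤j (<⇒≱ j<m)
    vanish (no _)    = refl

  cross : ℕ → ℕ → ℕ
  cross u v = a u * lag a v 1 + lag a u 1 * a v

  conv : ℕ → ℕ → ℕ
  conv x y = Σ< y (λ j → lag a x (suc j) * lag a y (suc j) * Pᵗ j)

  cross-sym : ∀ u v → cross u v ≡ cross v u
  cross-sym u v = trans (+-comm (a u * lag a v 1) _) (cong₂ _+_ (*-comm (lag a u 1) (a v)) (*-comm (a u) (lag a v 1)))

  conv-extend : ∀ x y n → y ≤ n → Σ< n (λ j → lag a x (suc j) * lag a y (suc j) * Pᵗ j) ≡ conv x y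
  conv-extend x y n y≤n = Σ<-vanishing _ y≤n λ j y≤j →
    trans (cong (λ l → lag a x (suc j) * l * Pᵗ j) (lag-< a y (suc j) (s≤s y≤j)))
          (cong (_* Pᵗ j) (*-zeroʳ (lag a x (suc j))))

  conv-sym : ∀ x y → conv x y ≡ conv y x
  conv-sym x y = begin
    conv x y
      ≡⟨ conv-extend x y (x ⊔ y) (m≤n⊔m x y) ⟨
    Σ< (x ⊔ y) (λ j → lag a x (suc j) * lag a y (suc j) * Pᵗ j)
      ≡⟨ Σ<-cong (x ⊔ y) (λ j _ → cong (_* Pᵗ j) (*-comm (lag a x (suc j)) _)) ⟩
    Σ< (x ⊔ y) (λ j → lag a y (suc j) * lag a x (suc j) * Pᵗ j)
      ≡⟨ conv-extend y x (x ⊔ y) (m≤m⊔n x y) ⟩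
    conv y x
      ∎

  lag-suc-when : ∀ w d → d ≤ suc w → lag a (2 + w) d ≡ lag a (suc w) d + when (m ≤? w) (lag a (w ∸ m) d)
  lag-suc-when w d d≤1+w = trans (lag-suc (suc w) d d≤1+w) (cong (_+_ (lag a (suc w) d)) (lag-far w d))

  cross-split : ∀ w v → cross (2 + w) v ≡ cross (suc w) v + when (m ≤? w) (cross (w ∸ m) v)
  cross-split w v = trans (cong₂ (λ s t → s * lag a v 1 + t * a v) (lag-suc-when w 0 z≤n) (lag-suc-when w 1 (s≤s z≤n)))
    (when-bilinear (m ≤? w) (a (suc w)) (a (w ∸ m)) (a w) (lag a (w ∸ m) 1) (lag a v 1) (a v))

  conv-split : ∀ w v → v ≤ suc w → conv (2 + w) v ≡ conv (suc w) v + when (m ≤? w) (conv (w ∸ m) v)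
  conv-split w v v≤1+w = begin
    conv (2 + w) v
      ≡⟨ Σ<-cong v (λ j j<v → trans (cong (λ l → l * lag a v (suc j) * Pᵗ j) (lag-suc-when w (suc j) (≤-trans j<v v≤1+w)))
                                    (when-scale (m ≤? w) (lag a (suc w) (suc j)) (lag a (w ∸ m) (suc j)) (lag a v (suc j)) (Pᵗ j))) ⟩
    Σ< v (λ j → lag a (suc w) (suc j) * lag a v (suc j) * Pᵗ j + when (m ≤? w) (lag a (w ∸ m) (suc j) * lag a v (suc j) * Pᵗ j))
      ≡⟨ Σ<-+ v _ _ ⟩
    conv (suc w) v + Σ< v (λ j → when (m ≤? w) (lag a (w ∸ m) (suc j) * lag a v (suc j) * Pᵗ j))
      ≡⟨ cong (_+_ (conv (suc w) v)) (Σ<-when (m ≤? w) v _) ⟩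
    conv (suc w) v + when (m ≤? w) (conv (w ∸ m) v)
      ∎

  conv-diagonal-suc : ∀ k′ → let k = suc k′ ; y = k′ ∸ m in
    conv (suc k) (suc k) ≡ conv k k + when (m ≤? k′) (completions m k y + 2 * conv k y + conv y y)
  conv-diagonal-suc k′ = begin
    conv (suc k) (suc k)
      ≡⟨ cong₂ _+_ (Σ<-cong k (λ j j<k → trans (cong (λ l → l * l * Pᵗ j) (lag-suc-when k′ (suc j) j<k))
                                              (when-square (m ≤? k′) (Xₖ j) (Xᵧ j) (Pᵗ j))))
                   (trans (cong (λ l → l * l * Pᵗ k) (trans (lag-self a (suc k)) a-zero)) (+-identityʳ (Pᵗ k))) ⟩
    Σ< k (λ j → Xₖ j * Xₖ j * Pᵗ j + L (2 * (Xₖ j * Xᵧ j * Pᵗ j) + Xᵧ j * Xᵧ j * Pᵗ j)) + Pᵗ k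
      ≡⟨ cong₂ _+_ (trans (Σ<-+ k _ _) (cong (_+_ (conv k k)) (Σ<-when (m ≤? k′) k _))) (Pᵗ-suc k′) ⟩
    conv k k + L (Σ< k (λ j → 2 * (Xₖ j * Xᵧ j * Pᵗ j) + Xᵧ j * Xᵧ j * Pᵗ j)) + L (completions m k y)
      ≡⟨ cong (λ t → conv k k + L t + L (completions m k y))
              (trans (Σ<-+ k _ _) (cong₂ _+_ (trans (Σ<-*ˡ k 2 _) (cong (2 *_) (conv-extend k y k y≤k))) (conv-extend y y k y≤k))) ⟩
    conv k k + L (2 * conv k y + conv y y) + L (completions m k y)
      ≡⟨ +-assoc (conv k k) _ _ ⟩
    conv k k + (L (2 * conv k y + conv y y) + L (completions m k y))
      ≡⟨ cong (_+_ (conv k k)) (trans (when-+ (m ≤? k′) _ _)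
           (cong L (trans (+-comm _ (completions m k y)) (sym (+-assoc (completions m k y) (2 * conv k y) (conv y y)))))) ⟩
    conv k k + L (completions m k y + 2 * conv k y + conv y y)
      ∎
    where
    k = suc k′
    y = k′ ∸ m
    L = when (m ≤? k′)
    Xₖ Xᵧ : ℕ → ℕ
    Xₖ j = lag a k (suc j)
    Xᵧ j = lag a y (suc j)
    y≤k : y ≤ k
    y≤k = ≤-trans (m∸n≤m k′ m) (n≤1+n k′)

  CrossIdentity : ℕ → ℕ → Set
  CrossIdentity u v = cross u v ≡ completions m u v + 2 * conv u v

  Diagonal : ℕ → Set
  Diagonal w = a w * lag a w 1 ≡ conv w w

  Identities : ℕ → Set
  Identities u = (∀ {v} → v < u → CrossIdentity u v) × Diagonal u

  Below : ℕ → Set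
  Below n = ∀ {k} → k < n → Identities k

  cross-any : ∀ {n} → Below n → ∀ {x v} → x < n → v < n →
    cross x v ≡ unless (x ≟ v) (completions m (x ⊔ v) (x ⊓ v)) + 2 * conv x v
  cross-any ih {x} {v} x<n v<n with x ≟ v
  ... | yes refl = begin
    a x * lag a x 1 + lag a x 1 * a x     ≡⟨ cong (_+_ (a x * lag a x 1)) (trans (*-comm (lag a x 1) (a x)) (sym (+-identityʳ _))) ⟩
    2 * (a x * lag a x 1)                 ≡⟨ cong (2 *_) (proj₂ (ih x<n)) ⟩
    2 * conv x x                          ∎
  ... | no x≢v with ≤-total x v
  ...   | inj₂ v≤x rewrite m≥n⇒m⊔n≡m v≤x | m≥n⇒m⊓n≡n v≤x = proj₁ (ih x<n) (≤∧≢⇒< v≤x (x≢v ∘ sym))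
  ...   | inj₁ x≤v rewrite m≤n⇒m⊔n≡n x≤v | m≤n⇒m⊓n≡m x≤v = begin
    cross x v                              ≡⟨ cross-sym x v ⟩
    cross v x                              ≡⟨ proj₁ (ih v<n) (≤∧≢⇒< x≤v x≢v) ⟩
    completions m v x + 2 * conv v x       ≡⟨ cong (λ c → completions m v x + 2 * c) (conv-sym v x) ⟩
    completions m v x + 2 * conv x v       ∎

  cross-step : ∀ w → Below (2 + w) → ∀ {v} → v < 2 + w → CrossIdentity (2 + w) v
  cross-step w ih {v} v<2+w = begin
    cross (2 + w) v
      ≡⟨ cross-split w v ⟩
    cross (suc w) v + L (cross (w ∸ m) v)
      ≡⟨ cong₂ _+_ (cross-any ih (n<1+n _) v<2+w) (cong L (cross-any ih w∸m<2+w v<2+w)) ⟩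
    (U₁ + 2 * conv (suc w) v) + L (U₂ + 2 * conv (w ∸ m) v)
      ≡⟨ when-affine (m ≤? w) U₁ (conv (suc w) v) U₂ (conv (w ∸ m) v) ⟩
    (U₁ + L U₂) + 2 * (conv (suc w) v + L (conv (w ∸ m) v))
      ≡⟨ cong₂ (λ s t → s + 2 * t) (sym unfold) (sym (conv-split w v (≤-pred v<2+w))) ⟩
    completions m (2 + w) v + 2 * conv (2 + w) v
      ∎
    where
    L = when (m ≤? w)
    U₁ = unless (suc w ≟ v) (completions m (suc w ⊔ v) (suc w ⊓ v))
    U₂ = unless (w ∸ m ≟ v) (completions m ((w ∸ m) ⊔ v) ((w ∸ m) ⊓ v))
    w∸m<2+w : w ∸ m < 2 + w
    w∸m<2+w = s≤s (≤-trans (m∸n≤m w m) (n≤1+n w))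
    v≤1+w = ≤-pred v<2+w
    unfold : completions m (2 + w) v ≡ U₁ + L U₂
    unfold = trans (completions-unfold m w v v<2+w)
      (cong (λ c → unless (suc w ≟ v) c + L U₂) (sym (cong₂ (completions m) (m≥n⇒m⊔n≡m v≤1+w) (m≥n⇒m⊓n≡n v≤1+w))))

  diagonal-step : ∀ k′ → Below (2 + k′) → Diagonal (2 + k′)
  diagonal-step k′ ih = begin
    a (suc k) * a k
      ≡⟨ cong₂ _*_ (lag-suc-when k′ 0 z≤n) (lag-suc-when k′ 1 (s≤s z≤n)) ⟩
    (a k + L (a y)) * (a k′ + L (lag a y 1))
      ≡⟨ when-product (m ≤? k′) (a k) (a y) (a k′) (lag a y 1) ⟩
    a k * a k′ + L (cross k y + a y * lag a y 1)
      ≡⟨ cong₂ _+_ (proj₂ (ih k<2+k′)) (cong L (cong₂ _+_ (proj₁ (ih k<2+k′) y<k) (proj₂ (ih (<-trans y<k k<2+k′))))) ⟩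
    conv k k + L (completions m k y + 2 * conv k y + conv y y)
      ≡⟨ conv-diagonal-suc k′ ⟨
    conv (suc k) (suc k)
      ∎
    where
    k = suc k′
    y = k′ ∸ m
    L = when (m ≤? k′)
    k<2+k′ : k < 2 + k′
    k<2+k′ = n<1+n k
    y<k : y < k
    y<k = s≤s (m∸n≤m k′ m)

  identities : ∀ n → Identities n
  identities = <-rec Identities step
    where
    step : ∀ n → Below n → Identities n
    step zero          _  = (λ ()) , *-zeroʳ (a 0)
    step (suc zero)    _  = cross-1-0 , diagonal-1
      where
      a1≡1 : a 1 ≡ 1
      a1≡1 = trans (a-suc 0) (trans (cong₂ _+_ a-zero (lag-< a 1 (m + 2) (m≤n+m 2 m))) refl)
      cross-1-0 : ∀ {v} → v < 1 → CrossIdentity 1 v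
      cross-1-0 {zero} _ rewrite a-zero | *-zeroʳ (a 1) = refl
      cross-1-0 {suc v} (s≤s ())
      diagonal-1 : Diagonal 1
      diagonal-1 rewrite a1≡1 | a-zero = refl
    step (suc (suc w)) ih = cross-step w ih , diagonal-step w ih

  diagonal : ∀ w → a w * lag a w 1 ≡ conv w w
  diagonal w = proj₂ (identities w)

  a-suc-unlagged : ∀ M → a (suc (M + m + 1)) ≡ a (M + m + 1) + a M
  a-suc-unlagged M = trans (a-suc (M + m + 1)) (cong (_+_ (a (M + m + 1))) (begin
    lag a (suc (M + m + 1)) (m + 2)          ≡⟨ cong₂ (lag a) (top M m) (sym (+-identityʳ (m + 2))) ⟩
    lag a ((m + 2) + M) ((m + 2) + 0)        ≡⟨ lag-+ a (m + 2) M 0 ⟩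
    a M                                      ∎))
    where
    top : ∀ M m → suc (M + m + 1) ≡ (m + 2) + M
    top = solve-∀

  shifted-product : ∀ M → a (M + m + 1) * a M ≡ Σ< (suc M) (λ i → Pᵗ (M + m + 1 ∸ i) * a i ^ 2)
  shifted-product M = +-cancelˡ-≡ (a L * a L) _ _ (begin
    a L * a L + a L * a M                ≡⟨ *-distribˡ-+ (a L) (a L) (a M) ⟨
    a L * (a L + a M)                    ≡⟨ *-comm (a L) _ ⟩
    (a L + a M) * a L                    ≡⟨ cong (_* a L) (a-suc-unlagged M) ⟨
    a (suc L) * a L                      ≡⟨ diagonal (suc L) ⟩
    conv (suc L) (suc L)                 ≡⟨ Σ<-head L _ ⟩
    a L * a L * 1 + Σ< L h               ≡⟨ cong₂ _+_ (*-identityʳ (a L * a L)) (cong (λ n → Σ< n h) L≡m+1+M) ⟩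
    a L * a L + Σ< (m + suc M) h         ≡⟨ cong (_+_ (a L * a L)) (Σ<-split m (suc M) h) ⟩
    a L * a L + (Σ< m h + Σ< (suc M) (λ i → h (m + i)))
        ≡⟨ cong (λ t → a L * a L + (t + Σ< (suc M) (λ i → h (m + i))))
             (Σ<-zero m (λ j j<m → trans (cong (lag a L (suc j) * lag a L (suc j) *_) (Pᵗ-small j j<m))
                                         (*-zeroʳ (lag a L (suc j) * lag a L (suc j))))) ⟩
    a L * a L + Σ< (suc M) (λ i → h (m + i))
        ≡⟨ cong (_+_ (a L * a L)) (trans (sym (Σ<-reverse (suc M) _)) (Σ<-cong (suc M) term)) ⟩
    a L * a L + Σ< (suc M) (λ i → Pᵗ (L ∸ i) * a i ^ 2) ∎)
    where
    L = M + m + 1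
    h : ℕ → ℕ
    h j = lag a L (suc j) * lag a L (suc j) * Pᵗ (suc j)
    L≡m+1+M : L ≡ m + suc M
    L≡m+1+M = solve-L M m
      where
      solve-L : ∀ M m → M + m + 1 ≡ m + suc M
      solve-L = solve-∀
    L≡1+m+M : L ≡ suc m + M
    L≡1+m+M = trans L≡m+1+M (+-suc m M)
    term : ∀ i → i < suc M → h (m + (suc M ∸ suc i)) ≡ Pᵗ (L ∸ i) * a i ^ 2
    term i (s≤s i≤M) = trans (cong₂ (λ x j → x * x * Pᵗ j) lag≡ index≡)
                             (trans (*-comm (a i * a i) _) (cong (Pᵗ (L ∸ i) *_) (cong (a i *_) (sym (*-identityʳ (a i))))))
      where
      lag≡ : lag a L (suc (m + (M ∸ i))) ≡ a i
      lag≡ = begin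
        lag a L (suc m + (M ∸ i))           ≡⟨ cong (λ x → lag a x (suc m + (M ∸ i))) L≡1+m+M ⟩
        lag a (suc m + M) (suc m + (M ∸ i)) ≡⟨ lag-+ a (suc m) M (M ∸ i) ⟩
        lag a M (M ∸ i)                     ≡⟨ lag-≤ a M (M ∸ i) (m∸n≤m M i) ⟩
        a (M ∸ (M ∸ i))                     ≡⟨ cong a (m∸[m∸n]≡n i≤M) ⟩
        a i                                 ∎
      index≡ : suc (m + (M ∸ i)) ≡ L ∸ i
      index≡ = begin
        suc (m + (M ∸ i))   ≡⟨ +-comm 1 (m + (M ∸ i)) ⟩
        m + (M ∸ i) + 1     ≡⟨ cong (_+ 1) (+-∸-assoc m i≤M) ⟨
        m + M ∸ i + 1       ≡⟨ +-∸-comm 1 (≤-trans i≤M (m≤n+m M m)) ⟨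
        m + M + 1 ∸ i       ≡⟨ cong (λ x → x + 1 ∸ i) (+-comm m M) ⟩
        L ∸ i               ∎

  square-step : ∀ M → a (suc (M + m + 1)) ^ 2
    ≡ a M ^ 2 + (a (M + m + 1) ^ 2 + 2 * Σ< (suc M) (λ i → Pᵗ (M + m + 1 ∸ i) * a i ^ 2))
  square-step M = begin
    a (suc L) ^ 2                      ≡⟨ cong (_^ 2) (a-suc-unlagged M) ⟩
    (a L + a M) ^ 2                    ≡⟨ binomial (a L) (a M) ⟩
    a M ^ 2 + (a L ^ 2 + 2 * (a L * a M)) ≡⟨ cong (λ t → a M ^ 2 + (a L ^ 2 + 2 * t)) (shifted-product M) ⟩
    a M ^ 2 + (a L ^ 2 + 2 * Σ< (suc M) (λ i → Pᵗ (L ∸ i) * a i ^ 2)) ∎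
    where
    L = M + m + 1
    binomial : ∀ x y → (x + y) * ((x + y) * 1) ≡ y * (y * 1) + (x * (x * 1) + 2 * (x * y))
    binomial = solve-∀

  square-initial : ∀ j → j ≤ m + 1 → a j ^ 2 ≡ δ j 0 + (1 ∸ δ j 0) * lag a j 1 ^ 2
  square-initial zero    _     rewrite a-zero = refl
  square-initial (suc j) 1+j≤m+1 = begin
    a (suc j) ^ 2                     ≡⟨ cong (_^ 2) (a-suc j) ⟩
    (a j + lag a (suc j) (m + 2)) ^ 2
      ≡⟨ cong (λ x → (a j + x) ^ 2) (lag-< a (suc j) (m + 2) (subst (suc (suc j) ≤_) (sym (+-suc m 1)) (s≤s 1+j≤m+1))) ⟩
    (a j + 0) ^ 2                     ≡⟨ cong (_^ 2) (+-identityʳ (a j)) ⟩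
    a j ^ 2                           ≡⟨ +-identityʳ (a j ^ 2) ⟨
    1 * a j ^ 2                       ∎

  square-recurrence : ∀ j n → a (suc n * (m + 2) + j) ^ 2
    ≡ a (n * (m + 2) + j) ^ 2
      + (a (suc n * (m + 2) + j ∸ 1) ^ 2
         + 2 * ∑ 0 (n * (m + 2) + j) (λ i → P (suc n * (m + 2) + j ∸ 1 ∸ i) (Wₘ m) * a i ^ 2))
  square-recurrence j n = begin
    a (suc n * (m + 2) + j) ^ 2
      ≡⟨ cong (λ x → a x ^ 2) top ⟩
    a (suc (N + m + 1)) ^ 2
      ≡⟨ square-step N ⟩
    a N ^ 2 + (a (N + m + 1) ^ 2 + 2 * Σ< (suc N) (λ i → Pᵗ (N + m + 1 ∸ i) * a i ^ 2))
      ≡⟨ cong₂ (λ x t → a N ^ 2 + (a x ^ 2 + 2 * t)) (sym (cong (_∸ 1) top)) (Σ<-cong (suc N) λ i _ →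
           cong (_* a i ^ 2) (trans (sym (P≡completions m (N + m + 1 ∸ i))) (cong (λ x → P (x ∸ 1 ∸ i) (Wₘ m)) (sym top)))) ⟩
    a N ^ 2 + (a (suc n * (m + 2) + j ∸ 1) ^ 2 + 2 * Σ< (suc N) (λ i → P (suc n * (m + 2) + j ∸ 1 ∸ i) (Wₘ m) * a i ^ 2))
      ≡⟨ cong (λ t → a N ^ 2 + (a (suc n * (m + 2) + j ∸ 1) ^ 2 + 2 * t)) (sym (∑≡Σ< 0 N _)) ⟩
    a N ^ 2 + (a (suc n * (m + 2) + j ∸ 1) ^ 2 + 2 * ∑ 0 N (λ i → P (suc n * (m + 2) + j ∸ 1 ∸ i) (Wₘ m) * a i ^ 2))
      ∎
    where
    N = n * (m + 2) + j
    top : suc n * (m + 2) + j ≡ suc (N + m + 1)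
    top = solve-top n m j
      where
      solve-top : ∀ n m j → suc n * (m + 2) + j ≡ suc (n * (m + 2) + j + m + 1)
      solve-top = solve-∀

lag-⊖ : ∀ (s : ℤ → ℕ) → (∀ k → s -[1+ k ] ≡ 0) → ∀ x d → s (x ⊖ d) ≡ lag (λ y → s (+ y)) x d
lag-⊖ s s-neg x       zero    = refl
lag-⊖ s s-neg zero    (suc d) = s-neg d
lag-⊖ s s-neg (suc x) (suc d) = trans (cong s ([1+m]⊖[1+n]≡m⊖n x d)) (lag-⊖ s s-neg x d)

mainTheorem7 : (m : ℕ) (s : ℤ → ℕ) →
    (∀ k → s -[1+ k ] ≡ 0) →
    (∀ n → s (+ n) ≡ δ n 0 + s ((+ n) - (+ 1)) + s ((+ n) - (+ (m + 2)))) →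
    ∀ n j → j ≤ m + 1 →
    s (+ (n * (m + 2) + j)) ^ 2
      ≡ δ j 0 + (1 ∸ δ j 0) * s ((+ j) - (+ 1)) ^ 2
        + ∑ 1 n (λ k → s (+ (k * (m + 2) + j ∸ 1)) ^ 2
            + 2 * ∑ 0 ((k ∸ 1) * (m + 2) + j)
                (λ i → P (k * (m + 2) + j ∸ 1 ∸ i) (-[1+ 1 ] ∷ -[1+ 0 ] ∷ + m ∷ []) * s (+ i) ^ 2))
mainTheorem7 m s s-neg s-rec n j j≤m+1 = begin
  a (n * (m + 2) + j) ^ 2
    ≡⟨ telescope (λ n → a (n * (m + 2) + j) ^ 2) increment (square-recurrence j) n ⟩
  a j ^ 2 + ∑ 1 n increment
    ≡⟨ cong (_+ ∑ 1 n increment) (trans (square-initial j j≤m+1) (cong (λ x → δ j 0 + (1 ∸ δ j 0) * x ^ 2) (sym (s-lag j 1)))) ⟩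
  δ j 0 + (1 ∸ δ j 0) * s ((+ j) - (+ 1)) ^ 2 + ∑ 1 n increment
    ∎
  where
  a : ℕ → ℕ
  a x = s (+ x)
  s-lag : ∀ x d → s ((+ x) - (+ d)) ≡ lag a x d
  s-lag x d = trans (cong s ([+m]-[+n]≡m⊖n x d)) (lag-⊖ s s-neg x d)
  a-zero : a 0 ≡ 1
  a-zero = trans (s-rec 0) (cong₂ (λ x y → 1 + x + y) (s-lag 0 1)
    (trans (s-lag 0 (m + 2)) (lag-< a 0 (m + 2) (≤-trans (s≤s z≤n) (m≤n+m 2 m)))))
  a-suc : ∀ x → a (suc x) ≡ a x + lag a (suc x) (m + 2)
  a-suc x = trans (s-rec (suc x)) (cong₂ _+_ (s-lag (suc x) 1) (s-lag (suc x) (m + 2)))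
  open Recurrence m a a-zero a-suc
  increment : ℕ → ℕ
  increment k = a (k * (m + 2) + j ∸ 1) ^ 2
    + 2 * ∑ 0 ((k ∸ 1) * (m + 2) + j) (λ i → P (k * (m + 2) + j ∸ 1 ∸ i) (Wₘ m) * a i ^ 2)
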